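{- Let $k$ be a field and let $\Delta$ be a simplicial complex with at least one vertex, with facets $A_1,\dots,A_r$, and let $d=\dim k[\Delta]$ be the maximum cardinality of a facet of $\Delta$. Then $\tilde H_i(N_j(\Delta);k)=0$ for all integers $i,j$ with $i+j>d$ and $1\le j\le d$.
   Context: For an integer $i$, the $i$-th nerve complex of $\Delta$ is the simplicial complex on vertex set $[r]=\{1,\dots,r\}$ given by $N_i(\Delta)=\{F\subseteq[r] : |\bigcap_{j\in F}A_j|\ge i\}$ (the empty set is always a face). $k[\Delta]$ denotes the Stanley–Reisner ring of $\Delta$ over $k$, whose Krull dimension equals the maximum cardinality of a facet. $\tilde H_i$ denotes reduced simplicial homology with coefficients in $k$. -}

module Defs where

open import Level using (Level; _⊔_)
open import Data.Bool using (Bool; true; false; if_then_else_)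
open import Data.Nat as ℕ using (ℕ; zero; suc)
open import Data.Nat.Base using (_<ᵇ_)
open import Data.Integer as ℤ using (ℤ; +_; _≤_)
open import Data.Fin using (Fin; toℕ)
import Data.Fin as Fin
open import Data.Fin.Subset using (Subset; ∣_∣; _∩_; _∪_; ⁅_⁆; _⊆_; Nonempty)
import Data.Fin.Subset as Sub
open import Data.Vec using (tabulate; lookup)
open import Data.Product using (Σ; ∃; _×_)
open import Data.Sum using (_⊎_)
open import Relation.Nullary using (¬_)
open import Relation.Binary.PropositionalEquality using (_≡_)
open import Algebra.Bundles using (CommutativeRing)

record Field (c ℓ : Level) : Set (Level.suc (c ⊔ ℓ)) where
  field
    commutativeRing : CommutativeRing c ℓ
  open CommutativeRing commutativeRing public
  field
    0≉1     : ¬ (0# ≈ 1#)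
    inverse : ∀ x → ¬ (x ≈ 0#) → Σ Carrier (λ y → (x * y) ≈ 1#)

-- (Homology below only uses the face predicate, so complexes are
-- passed simply as their face predicate.)
FacePred : ℕ → Set₁
FacePred r = Subset r → Set

module Homology {c ℓ : Level} (K : Field c ℓ) where
  open Field K

  ∑ : (n : ℕ) → (Fin n → Carrier) → Carrier
  ∑ zero    f = 0#
  ∑ (suc n) f = f Fin.zero + ∑ n (λ i → f (Fin.suc i))

  sgn : ℕ → Carrier
  sgn zero    = 1#
  sgn (suc m) = - sgn m

  below : ∀ {r} → Fin r → Subset r
  below v = tabulate (λ u → toℕ u <ᵇ toℕ v)

  Chain : ℕ → Set c
  Chain r = Subset r → Carrier

  IsChain : ∀ {r} → FacePred r → ℤ → Chain r → Set ℓ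
  IsChain {r} Δ i ch =
    ∀ F → ¬ (Δ F × (+ ∣ F ∣) ≡ i ℤ.+ ℤ.1ℤ) → ch F ≈ 0#

  -- simplicial boundary:  ∂[v₀<…<v_m] = ∑ⱼ (-1)ʲ [v₀…v̂ⱼ…v_m];
  -- coefficient of G in ∂ ch is ∑_{v ∉ G} (-1)^{#{u ∈ G : u < v}} ch(G ∪ {v}).
  ∂ : ∀ {r} → Chain r → Chain r
  ∂ {r} ch G =
    ∑ r (λ v → if lookup G v then 0#
               else sgn ∣ G ∩ below v ∣ * ch (G ∪ ⁅ v ⁆))

  IsCycle : ∀ {r} → FacePred r → ℤ → Chain r → Set ℓ
  IsCycle Δ i ch = IsChain Δ i ch × (∀ G → ∂ ch G ≈ 0#)

  IsBoundary : ∀ {r} → FacePred r → ℤ → Chain r → Set (c ⊔ ℓ)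
  IsBoundary Δ i ch = ∃ λ b → IsChain Δ (i ℤ.+ ℤ.1ℤ) b × (∀ G → ∂ b G ≈ ch G)

  ReducedHomologyVanishes : ∀ {r} → FacePred r → ℤ → Set (c ⊔ ℓ)
  ReducedHomologyVanishes Δ i = ∀ ch → IsCycle Δ i ch → IsBoundary Δ i ch

AreFacets : ∀ {n r} → (Fin r → Subset n) → Set
AreFacets {r = r} A = ∀ (a b : Fin r) → A a ⊆ A b → a ≡ b

maxCard : ∀ {n} (r : ℕ) → (Fin r → Subset n) → ℕ
maxCard zero    A = 0
maxCard (suc r) A = ∣ A Fin.zero ∣ ℕ.⊔ maxCard r (λ a → A (Fin.suc a))

-- ⋂_{a ∈ F} A a  (the full vertex set when F = ∅)
⋂ : ∀ {n} (r : ℕ) → (Fin r → Subset n) → Subset r → Subset n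
⋂ zero    A F = Sub.⊤
⋂ (suc r) A F =
  (if lookup F Fin.zero then A Fin.zero else Sub.⊤)
    ∩ ⋂ r (λ a → A (Fin.suc a)) (λ' F)
  where
  λ' : Subset (suc r) → Subset r
  λ' = Data.Vec.tail

nerveFace : ∀ {n r} → (Fin r → Subset n) → ℤ → Subset r → Set
nerveFace {r = r} A i F = F ≡ Sub.⊥ ⊎ i ≤ + ∣ ⋂ r A F ∣

module Submission where

-- The proof is an induction on the number
-- of vertices of the complex, driven by a Mayer–Vietoris argument that is
-- carried out directly on chains.  For the induction the nerve is generalised
-- to N_j(A, V), whose faces are subsets of a set V of facet indices.  Deleting
-- the first vertex x₀ gives facets B_a = A_a ∖ {x₀}; with W = {a : x₀ ∈ A_a},
--     N_j(A, V) = N_j(B, V) ∪ N_{j-1}(B, V ∩ W),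
--     N_j(B, V) ∩ N_{j-1}(B, V ∩ W) = N_j(B, V ∩ W),
-- and the facets indexed by V ∩ W have lost a vertex, so the bound d drops by
-- one on those pieces.  Once no vertex is left, a nerve is either a full
-- simplex (acyclic, since it is a cone) or has only the empty face.

open import Defs
open import Level using (Level)
open import Data.Nat using (ℕ)
open import Data.Integer using (ℤ; +_; _+_; _<_; _≤_)
open import Data.Fin using (Fin)
open import Data.Fin.Subset using (Subset; Nonempty)
open import Data.Product using (∃)

open import Data.Bool using (Bool; true; false; if_then_else_; _∧_; _∨_; not)
import Data.Bool.Properties as BoolP
import Data.Nat as ℕ
import Data.Nat.Properties as ℕP
open import Data.Nat.Base using (_<ᵇ_)
import Data.Integer as ℤ
import Data.Integer.Properties as ℤP
import Data.Fin as Fin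
import Data.Fin.Properties as FinP
open import Data.Fin.Subset
  using (_∈_; _∉_; _⊆_; _∪_; _∩_; ∁; ⁅_⁆; ∣_∣; ⊤; ⊥; Empty)
open import Data.Fin.Subset.Properties
  using ( x∈p∪q⁺; x∈p∪q⁻; x∈p∩q⁺; x∈p∩q⁻; x∈⁅x⁆; x∈⁅y⁆⇒x≡y; x≢y⇒x∉⁅y⁆; ∈⊤
        ; p⊆q⇒∣p∣≤∣q∣; p⊆p∪q; ⊆-antisym; ∪-assoc; ∪-comm; ∪-identityʳ
        ; drop-there; Empty-unique; nonempty?; ∣⊥∣≡0; _⊆?_; ∣p∣≤∣x∷p∣; ∉⊥; p∩q⊆p; p∩q⊆q)
open import Data.Vec using (_∷_; []; lookup; tabulate; head; tail; here; there)
open import Data.Vec.Properties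
  using (lookup-zipWith; lookup-map; tabulate∘lookup; tabulate-cong; []=⇒lookup; lookup⇒[]=; lookup∘tabulate; ≡-dec)
open import Data.Product using (_×_; _,_; proj₁; proj₂)
open import Data.Sum using (inj₁; inj₂)
open import Function using (_∘_)
open import Relation.Nullary using (¬_; yes; no; does; contradiction)
open import Relation.Nullary.Decidable using (_×-dec_; _⊎-dec_)
open import Relation.Binary.PropositionalEquality
  using (_≡_; _≢_; refl; sym; trans; cong; cong₂; subst; subst₂; module ≡-Reasoning)
import Relation.Unary as U
open import Relation.Unary.Properties using (≐-sym)

module _ {n : ℕ} where

  -- The boundary operator ∂ of Defs inspects membership as a Boolean.
  ∈⇒lookup : ∀ {x : Fin n} {p} → x ∈ p → lookup p x ≡ true
  ∈⇒lookup = []=⇒lookup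

  ∉⇒lookup : ∀ {x : Fin n} {p} → x ∉ p → lookup p x ≡ false
  ∉⇒lookup {x} {p} x∉p with lookup p x in eq
  ... | true  = contradiction (lookup⇒[]= x p eq) x∉p
  ... | false = refl

  subset-ext : ∀ {p q : Subset n} → (∀ x → lookup p x ≡ lookup q x) → p ≡ q
  subset-ext {p} {q} same = begin
    p                   ≡⟨ sym (tabulate∘lookup p) ⟩
    tabulate (lookup p) ≡⟨ tabulate-cong same ⟩
    tabulate (lookup q) ≡⟨ tabulate∘lookup q ⟩
    q                   ∎
    where open ≡-Reasoning

  lookup-⁅⁆-self : ∀ (v : Fin n) → lookup ⁅ v ⁆ v ≡ true
  lookup-⁅⁆-self v = ∈⇒lookup (x∈⁅x⁆ v)

  lookup-⁅⁆-other : ∀ {v u : Fin n} → v ≢ u → lookup ⁅ v ⁆ u ≡ false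
  lookup-⁅⁆-other v≢u = ∉⇒lookup (x≢y⇒x∉⁅y⁆ (v≢u ∘ sym))

  lookup-insert : ∀ (G : Subset n) v u → lookup (G ∪ ⁅ v ⁆) u ≡ (lookup G u ∨ lookup ⁅ v ⁆ u)
  lookup-insert G v u = lookup-zipWith _∨_ u G ⁅ v ⁆

  insert-self : ∀ (G : Subset n) v → lookup (G ∪ ⁅ v ⁆) v ≡ true
  insert-self G v rewrite lookup-insert G v v | lookup-⁅⁆-self v = BoolP.∨-zeroʳ (lookup G v)

  insert-other : ∀ (G : Subset n) {v u} → v ≢ u → lookup (G ∪ ⁅ v ⁆) u ≡ lookup G u
  insert-other G {v} {u} v≢u rewrite lookup-insert G v u | lookup-⁅⁆-other v≢u = BoolP.∨-identityʳ (lookup G u)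

  insert-keeps : ∀ (G : Subset n) v {u} → lookup G u ≡ true → lookup (G ∪ ⁅ v ⁆) u ≡ true
  insert-keeps G v {u} u∈G rewrite lookup-insert G v u | u∈G = refl

  insert-comm : ∀ (G : Subset n) u v → (G ∪ ⁅ u ⁆) ∪ ⁅ v ⁆ ≡ (G ∪ ⁅ v ⁆) ∪ ⁅ u ⁆
  insert-comm G u v = begin
    (G ∪ ⁅ u ⁆) ∪ ⁅ v ⁆ ≡⟨ ∪-assoc G ⁅ u ⁆ ⁅ v ⁆ ⟩
    G ∪ (⁅ u ⁆ ∪ ⁅ v ⁆) ≡⟨ cong (G ∪_) (∪-comm ⁅ u ⁆ ⁅ v ⁆) ⟩
    G ∪ (⁅ v ⁆ ∪ ⁅ u ⁆) ≡⟨ sym (∪-assoc G ⁅ v ⁆ ⁅ u ⁆) ⟩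
    (G ∪ ⁅ v ⁆) ∪ ⁅ u ⁆ ∎
    where open ≡-Reasoning

  infixl 5 _∖_
  _∖_ : Subset n → Fin n → Subset n
  G ∖ w = G ∩ ∁ ⁅ w ⁆

  lookup-delete : ∀ (G : Subset n) w u → lookup (G ∖ w) u ≡ (lookup G u ∧ not (lookup ⁅ w ⁆ u))
  lookup-delete G w u = trans (lookup-zipWith _∧_ u G (∁ ⁅ w ⁆)) (cong (lookup G u ∧_) (lookup-map u not ⁅ w ⁆))

  delete-self : ∀ (G : Subset n) w → lookup (G ∖ w) w ≡ false
  delete-self G w rewrite lookup-delete G w w | lookup-⁅⁆-self w = BoolP.∧-zeroʳ (lookup G w)

  delete-other : ∀ (G : Subset n) {w u} → w ≢ u → lookup (G ∖ w) u ≡ lookup G u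
  delete-other G {w} {u} w≢u rewrite lookup-delete G w u | lookup-⁅⁆-other w≢u = BoolP.∧-identityʳ (lookup G u)

  delete-insert : ∀ (G : Subset n) {w} → lookup G w ≡ true → (G ∖ w) ∪ ⁅ w ⁆ ≡ G
  delete-insert G {w} w∈G = subset-ext same
    where
    same : ∀ u → lookup ((G ∖ w) ∪ ⁅ w ⁆) u ≡ lookup G u
    same u with w Fin.≟ u
    ... | yes refl = trans (insert-self (G ∖ w) w) (sym w∈G)
    ... | no w≢u   = trans (insert-other (G ∖ w) w≢u) (delete-other G w≢u)

  insert-delete : ∀ (G : Subset n) {w} → lookup G w ≡ false → (G ∪ ⁅ w ⁆) ∖ w ≡ G
  insert-delete G {w} w∉G = subset-ext same
    where
    same : ∀ u → lookup ((G ∪ ⁅ w ⁆) ∖ w) u ≡ lookup G u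
    same u with w Fin.≟ u
    ... | yes refl = trans (delete-self (G ∪ ⁅ w ⁆) w) (sym w∉G)
    ... | no w≢u   = trans (delete-other (G ∪ ⁅ w ⁆) w≢u) (insert-other G w≢u)

  insert-delete-comm : ∀ (G : Subset n) {v w} → v ≢ w → (G ∪ ⁅ v ⁆) ∖ w ≡ (G ∖ w) ∪ ⁅ v ⁆
  insert-delete-comm G {v} {w} v≢w = subset-ext same
    where
    same : ∀ u → lookup ((G ∪ ⁅ v ⁆) ∖ w) u ≡ lookup ((G ∖ w) ∪ ⁅ v ⁆) u
    same u with w Fin.≟ u
    ... | yes refl = trans (delete-self (G ∪ ⁅ v ⁆) w) (sym (trans (insert-other (G ∖ w) v≢w) (delete-self G w)))
    ... | no w≢u   = begin
      lookup ((G ∪ ⁅ v ⁆) ∖ w) u          ≡⟨ delete-other (G ∪ ⁅ v ⁆) w≢u ⟩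
      lookup (G ∪ ⁅ v ⁆) u                ≡⟨ lookup-insert G v u ⟩
      lookup G u ∨ lookup ⁅ v ⁆ u         ≡⟨ cong (_∨ lookup ⁅ v ⁆ u) (sym (delete-other G w≢u)) ⟩
      lookup (G ∖ w) u ∨ lookup ⁅ v ⁆ u   ≡⟨ sym (lookup-insert (G ∖ w) v u) ⟩
      lookup ((G ∖ w) ∪ ⁅ v ⁆) u          ∎
      where open ≡-Reasoning

∣insert∩∣ : ∀ {n} (G Y : Subset n) {v} → lookup G v ≡ false →
  ∣ (G ∪ ⁅ v ⁆) ∩ Y ∣ ≡ (if lookup Y v then ℕ.suc ∣ G ∩ Y ∣ else ∣ G ∩ Y ∣)
∣insert∩∣ (false ∷ G) (true  ∷ Y) {Fin.zero} refl = cong (λ H → ℕ.suc ∣ H ∩ Y ∣) (∪-identityʳ G)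
∣insert∩∣ (false ∷ G) (false ∷ Y) {Fin.zero} refl = cong (λ H → ∣ H ∩ Y ∣) (∪-identityʳ G)
∣insert∩∣ (true  ∷ G) (true  ∷ Y) {Fin.suc v} v∉G = trans (cong ℕ.suc (∣insert∩∣ G Y v∉G)) (suc-if (lookup Y v))
  where
  suc-if : ∀ b {k} → ℕ.suc (if b then ℕ.suc k else k) ≡ (if b then ℕ.suc (ℕ.suc k) else ℕ.suc k)
  suc-if true  = refl
  suc-if false = refl
∣insert∩∣ (true  ∷ G) (false ∷ Y) {Fin.suc v} v∉G = ∣insert∩∣ G Y v∉G
∣insert∩∣ (false ∷ G) (true  ∷ Y) {Fin.suc v} v∉G = ∣insert∩∣ G Y v∉G
∣insert∩∣ (false ∷ G) (false ∷ Y) {Fin.suc v} v∉G = ∣insert∩∣ G Y v∉G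

∣insert∣ : ∀ {n} (G : Subset n) {v} → lookup G v ≡ false → ∣ G ∪ ⁅ v ⁆ ∣ ≡ ℕ.suc ∣ G ∣
∣insert∣ (false ∷ G) {Fin.zero}  refl = cong (ℕ.suc ∘ ∣_∣) (∪-identityʳ G)
∣insert∣ (true  ∷ G) {Fin.suc v} v∉G  = cong ℕ.suc (∣insert∣ G v∉G)
∣insert∣ (false ∷ G) {Fin.suc v} v∉G  = ∣insert∣ G v∉G

module _ {m : ℕ} where

  ∣∣-first-in : ∀ {p : Subset (ℕ.suc m)} → Fin.zero ∈ p → ∣ p ∣ ≡ ℕ.suc ∣ tail p ∣
  ∣∣-first-in {true ∷ _} here = refl

  ∣∣-first-out : ∀ {p : Subset (ℕ.suc m)} → Fin.zero ∉ p → ∣ p ∣ ≡ ∣ tail p ∣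
  ∣∣-first-out {true  ∷ _} 0∉p = contradiction here 0∉p
  ∣∣-first-out {false ∷ _} _   = refl

  ∣tail∣≤ : ∀ (p : Subset (ℕ.suc m)) → ∣ tail p ∣ ℕ.≤ ∣ p ∣
  ∣tail∣≤ (x ∷ p) = ∣p∣≤∣x∷p∣ x p

∣∣-no-vertices : (p : Subset 0) → ∣ p ∣ ≡ 0
∣∣-no-vertices [] = refl

-- Integer bookkeeping for degrees (a face of degree i has i + 1 vertices)

+suc : ∀ n → + ℕ.suc n ≡ + n + ℤ.1ℤ
+suc n = ℤP.+-comm ℤ.1ℤ (+ n)

[i+1]-1≡i : ∀ i → i + ℤ.1ℤ ℤ.- ℤ.1ℤ ≡ i
[i+1]-1≡i i = trans (ℤP.+-assoc i ℤ.1ℤ ℤ.-1ℤ) (ℤP.+-identityʳ i)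

[i-1]+1≡i : ∀ i → i ℤ.- ℤ.1ℤ + ℤ.1ℤ ≡ i
[i-1]+1≡i i = trans (ℤP.+-assoc i ℤ.-1ℤ ℤ.1ℤ) (ℤP.+-identityʳ i)

+1-injective : ∀ {i k} → i + ℤ.1ℤ ≡ k + ℤ.1ℤ → i ≡ k
+1-injective {i} {k} eq = begin
  i                      ≡⟨ sym ([i+1]-1≡i i) ⟩
  i + ℤ.1ℤ ℤ.- ℤ.1ℤ      ≡⟨ cong (ℤ._- ℤ.1ℤ) eq ⟩
  k + ℤ.1ℤ ℤ.- ℤ.1ℤ      ≡⟨ [i+1]-1≡i k ⟩
  k                      ∎
  where open ≡-Reasoning

nonneg⇒i+1≢0 : ∀ {i} → ℤ.0ℤ ≤ i → + 0 ≢ i + ℤ.1ℤ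
nonneg⇒i+1≢0 {+ k} _ eq = ℕP.1+n≢0 (sym (trans (ℤP.+-injective eq) (ℕP.+-comm k 1)))

positive-gap : ∀ {d} i j → j ≤ d → d < i + j → ℤ.0ℤ < i
positive-gap {d} i j j≤d d<i+j with ℤ.0ℤ ℤP.<? i
... | yes 0<i = 0<i
... | no  0≮i = contradiction i+j≤j (ℤP.<⇒≱ (ℤP.≤-<-trans j≤d d<i+j))
  where
  i+j≤j : i + j ≤ j
  i+j≤j = subst (i + j ≤_) (ℤP.+-identityˡ j) (ℤP.+-monoˡ-≤ j (ℤP.≮⇒≥ 0≮i))

positive⇒pred-nonneg : ∀ {i} → ℤ.0ℤ < i → ℤ.0ℤ ≤ i ℤ.- ℤ.1ℤ
positive⇒pred-nonneg {i} 0<i = subst (ℤ.0ℤ ≤_) (ℤP.+-comm ℤ.-1ℤ i) (ℤP.i<j⇒i≤pred[j] 0<i)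

lower-d-and-j : ∀ {d} i j → d < i + j → d ℤ.- ℤ.1ℤ < i + (j ℤ.- ℤ.1ℤ)
lower-d-and-j {d} i j d<i+j = subst (d ℤ.- ℤ.1ℤ <_) (ℤP.+-assoc i j ℤ.-1ℤ) (ℤP.+-monoˡ-< ℤ.-1ℤ d<i+j)

lower-d-and-i : ∀ {d} i j → d < i + j → d ℤ.- ℤ.1ℤ < i ℤ.- ℤ.1ℤ + j
lower-d-and-i {d} i j d<i+j = subst (d ℤ.- ℤ.1ℤ <_) reorder (ℤP.+-monoˡ-< ℤ.-1ℤ d<i+j)
  where
  open ≡-Reasoning
  reorder : i + j ℤ.- ℤ.1ℤ ≡ i ℤ.- ℤ.1ℤ + j
  reorder = begin
    i + j + ℤ.-1ℤ      ≡⟨ ℤP.+-assoc i j ℤ.-1ℤ ⟩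
    i + (j + ℤ.-1ℤ)    ≡⟨ cong (λ k → i + k) (ℤP.+-comm j ℤ.-1ℤ) ⟩
    i + (ℤ.-1ℤ + j)    ≡⟨ ℤP.+-assoc i ℤ.-1ℤ j ⟨
    i + ℤ.-1ℤ + j      ∎

<ᵇ-asym : ∀ m n → m ≢ n → (n <ᵇ m) ≡ not (m <ᵇ n)
<ᵇ-asym ℕ.zero    ℕ.zero    m≢n = contradiction refl m≢n
<ᵇ-asym ℕ.zero    (ℕ.suc n) _   = refl
<ᵇ-asym (ℕ.suc m) ℕ.zero    _   = refl
<ᵇ-asym (ℕ.suc m) (ℕ.suc n) m≢n = <ᵇ-asym m n (m≢n ∘ cong ℕ.suc)

-- Closure under deleting a vertex; this is what makes ∂ act on chains.
DownwardClosed : ∀ {r} → FacePred r → Set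
DownwardClosed Δ = ∀ G v → Δ (G ∪ ⁅ v ⁆) → Δ G

IsConeWithApex : ∀ {r} → FacePred r → Fin r → Set
IsConeWithApex Δ w = ∀ F → Δ F → Δ (F ∪ ⁅ w ⁆)

Simplex : ∀ {r} → Subset r → FacePred r
Simplex V F = F ⊆ V

simplex-is-cone : ∀ {r} {V : Subset r} {w} → w ∈ V → IsConeWithApex (Simplex V) w
simplex-is-cone {V = V} {w} w∈V F F⊆V x∈F∪w with x∈p∪q⁻ F ⁅ w ⁆ x∈F∪w
... | inj₁ x∈F = F⊆V x∈F
... | inj₂ x∈w = subst (_∈ V) (sym (x∈⁅y⁆⇒x≡y w x∈w)) w∈V

-- The chain toolkit over a field K (only its ring structure is used)

module Chains {c ℓ : Level} (K : Field c ℓ) where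
  open Field K
    renaming (_+_ to _⊕_; _*_ to _⊗_; refl to ≈-refl; sym to ≈-sym; trans to ≈-trans; reflexive to ≈-reflexive)
  open Homology K
  open import Algebra.Properties.Ring ring
    using (-‿distribˡ-*; -‿distribʳ-*; -‿involutive; -0#≈0#; +-inverseʳ-unique; -1*x≈-x)
  open import Algebra.Properties.Semiring.Sum semiring
    using (sum; sum-cong-≋; sum-replicate-zero; sum-remove; ∑-distrib-+; *-distribˡ-sum)
  open import Algebra.Properties.CommutativeSemigroup *-commutativeSemigroup using (x∙yz≈y∙xz)
  open import Relation.Binary.Reasoning.Setoid setoid

  ∑≡sum : ∀ n (f : Fin n → Carrier) → ∑ n f ≡ sum f
  ∑≡sum ℕ.zero    f = refl
  ∑≡sum (ℕ.suc n) f = cong (f Fin.zero ⊕_) (∑≡sum n (f ∘ Fin.suc))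

  sum-zero : ∀ {n} {f : Fin n → Carrier} → (∀ v → f v ≈ 0#) → sum f ≈ 0#
  sum-zero {n} f≈0 = ≈-trans (sum-cong-≋ f≈0) (sum-replicate-zero n)

  sum-neg : ∀ {n} (f : Fin n → Carrier) → sum (λ v → - f v) ≈ - sum f
  sum-neg f = begin
    sum (λ v → - f v)       ≈⟨ sum-cong-≋ (λ v → ≈-sym (-1*x≈-x (f v))) ⟩
    sum (λ v → - 1# ⊗ f v)  ≈⟨ *-distribˡ-sum (- 1#) f ⟨
    - 1# ⊗ sum f            ≈⟨ -1*x≈-x (sum f) ⟩
    - sum f                 ∎

  sum-split : ∀ {n} (t R : Fin n → Carrier) w → R w ≈ 0# → (∀ v → v ≢ w → t v ≈ R v) →
              sum t ≈ t w ⊕ sum R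
  sum-split {ℕ.suc n} t R w Rw≈0 t≈R = begin
    sum t                                   ≈⟨ sum-remove {i = w} t ⟩
    t w ⊕ sum (λ k → t (Fin.punchIn w k))   ≈⟨ +-congˡ (sum-cong-≋ (λ k → t≈R _ (FinP.punchInᵢ≢i w k))) ⟩
    t w ⊕ sum (λ k → R (Fin.punchIn w k))   ≈⟨ +-congˡ (+-identityˡ _) ⟨
    t w ⊕ (0# ⊕ sum (λ k → R (Fin.punchIn w k)))
                                            ≈⟨ +-congˡ (+-congʳ Rw≈0) ⟨
    t w ⊕ (R w ⊕ sum (λ k → R (Fin.punchIn w k)))
                                            ≈⟨ +-congˡ (sum-remove {i = w} R) ⟨
    t w ⊕ sum R                             ∎

  sum-single : ∀ {n} (t : Fin n → Carrier) w → (∀ v → v ≢ w → t v ≈ 0#) → sum t ≈ t w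
  sum-single {n} t w t≈0 = begin
    sum t                      ≈⟨ sum-split t (λ _ → 0#) w ≈-refl t≈0 ⟩
    t w ⊕ sum {n} (λ _ → 0#)   ≈⟨ +-congˡ (sum-replicate-zero n) ⟩
    t w ⊕ 0#                   ≈⟨ +-identityʳ (t w) ⟩
    t w                        ∎

  -- A double sum of an antisymmetric array with zero diagonal vanishes; the
  -- terms cancel in pairs, so no assumption on the characteristic is needed.
  sum-antisymmetric : ∀ {n} (f : Fin n → Fin n → Carrier) →
    (∀ u → f u u ≈ 0#) → (∀ u v → f u v ⊕ f v u ≈ 0#) → sum (λ u → sum (f u)) ≈ 0#
  sum-antisymmetric {ℕ.zero}  f _    _    = ≈-refl
  sum-antisymmetric {ℕ.suc n} f diag anti = begin
    (f 0F 0F ⊕ row) ⊕ sum (λ u → f (Fin.suc u) 0F ⊕ sum (λ v → f (Fin.suc u) (Fin.suc v)))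
      ≈⟨ +-cong (+-congʳ (diag 0F)) (∑-distrib-+ (λ u → f (Fin.suc u) 0F) _) ⟩
    (0# ⊕ row) ⊕ (column ⊕ sum (λ u → sum (λ v → f (Fin.suc u) (Fin.suc v))))
      ≈⟨ +-cong (+-identityˡ row) (+-congˡ (sum-antisymmetric _ (diag ∘ Fin.suc) (λ u v → anti (Fin.suc u) (Fin.suc v)))) ⟩
    row ⊕ (column ⊕ 0#)
      ≈⟨ +-congˡ (+-identityʳ column) ⟩
    row ⊕ column
      ≈⟨ ∑-distrib-+ (λ v → f 0F (Fin.suc v)) (λ v → f (Fin.suc v) 0F) ⟨
    sum (λ v → f 0F (Fin.suc v) ⊕ f (Fin.suc v) 0F)
      ≈⟨ sum-zero (λ v → anti 0F (Fin.suc v)) ⟩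
    0# ∎
    where
    0F = Fin.zero
    row    = sum (λ v → f 0F (Fin.suc v))
    column = sum (λ u → f (Fin.suc u) 0F)

  unless : Bool → Carrier → Carrier
  unless b x = if b then 0# else x

  unless-false : ∀ {b} x → b ≡ false → unless b x ≡ x
  unless-false x refl = refl

  unless-true : ∀ {b} x → b ≡ true → unless b x ≡ 0#
  unless-true x refl = refl

  unless-cong : ∀ b {x y} → x ≈ y → unless b x ≈ unless b y
  unless-cong true  _   = ≈-refl
  unless-cong false x≈y = x≈y

  unless-zero : ∀ b {x} → x ≈ 0# → unless b x ≈ 0#
  unless-zero true  _   = ≈-refl
  unless-zero false x≈0 = x≈0

  unless-+ : ∀ b x y → unless b (x ⊕ y) ≈ unless b x ⊕ unless b y
  unless-+ true  _ _ = ≈-sym (+-identityˡ 0#)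
  unless-+ false _ _ = ≈-refl

  unless-neg : ∀ b x → unless b (- x) ≈ - unless b x
  unless-neg true  _ = ≈-sym -0#≈0#
  unless-neg false _ = ≈-refl

  unless-scale-sum : ∀ b a {n} (g : Fin n → Carrier) → unless b (a ⊗ sum g) ≈ sum (λ u → unless b (a ⊗ g u))
  unless-scale-sum true  a {n} g = ≈-sym (sum-zero {n} (λ _ → ≈-refl))
  unless-scale-sum false a g = *-distribˡ-sum a g

  sign : ∀ {r} → Subset r → Fin r → Carrier
  sign G v = sgn ∣ G ∩ below v ∣

  ∂-term : ∀ {r} → Chain r → Subset r → Fin r → Carrier
  ∂-term c G v = unless (lookup G v) (sign G v ⊗ c (G ∪ ⁅ v ⁆))

  ∂≡sum : ∀ {r} (c : Chain r) G → ∂ c G ≡ sum (∂-term c G)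
  ∂≡sum {r} c G = ∑≡sum r (∂-term c G)

  ∂-vanishes : ∀ {r} (c : Chain r) G → (∀ v → lookup G v ≡ false → c (G ∪ ⁅ v ⁆) ≈ 0#) → ∂ c G ≈ 0#
  ∂-vanishes c G c≈0 = ≈-trans (≈-reflexive (∂≡sum c G)) (sum-zero term≈0)
    where
    term≈0 : ∀ v → ∂-term c G v ≈ 0#
    term≈0 v with lookup G v in v∉G
    ... | true  = ≈-refl
    ... | false = ≈-trans (*-congˡ (c≈0 v v∉G)) (zeroʳ _)

  negateIf : Bool → Carrier → Carrier
  negateIf b x = if b then - x else x

  sgn-suc-if : ∀ b k → sgn (if b then ℕ.suc k else k) ≡ negateIf b (sgn k)
  sgn-suc-if true  k = refl
  sgn-suc-if false k = refl

  sign-insert : ∀ {r} (G : Subset r) {v} u → lookup G v ≡ false →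
    sign (G ∪ ⁅ v ⁆) u ≡ negateIf (Fin.toℕ v <ᵇ Fin.toℕ u) (sign G u)
  sign-insert G {v} u v∉G rewrite ∣insert∩∣ G (below u) v∉G
                                | lookup∘tabulate (λ w → Fin.toℕ w <ᵇ Fin.toℕ u) v
    = sgn-suc-if (Fin.toℕ v <ᵇ Fin.toℕ u) ∣ G ∩ below u ∣

  sign-cancel : ∀ {r} (G : Subset r) v x → sign G v ⊗ (sign G v ⊗ x) ≈ x
  sign-cancel G v x = begin
    s ⊗ (s ⊗ x)  ≈⟨ *-assoc _ _ _ ⟨
    (s ⊗ s) ⊗ x  ≈⟨ *-congʳ (sgn² ∣ G ∩ below v ∣) ⟩
    1# ⊗ x       ≈⟨ *-identityˡ x ⟩
    x            ∎
    where
    s = sign G v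
    sgn² : ∀ m → sgn m ⊗ sgn m ≈ 1#
    sgn² ℕ.zero    = *-identityˡ 1#
    sgn² (ℕ.suc m) = begin
      - sgn m ⊗ - sgn m      ≈⟨ -‿distribˡ-* _ _ ⟨
      - (sgn m ⊗ - sgn m)    ≈⟨ -‿cong (-‿distribʳ-* _ _) ⟨
      - - (sgn m ⊗ sgn m)    ≈⟨ -‿involutive _ ⟩
      sgn m ⊗ sgn m          ≈⟨ sgn² m ⟩
      1#                     ∎

  module _ {r} (G : Subset r) {u v : Fin r} (u≢v : u ≢ v)
           (u∉G : lookup G u ≡ false) (v∉G : lookup G v ≡ false) where

    private
      u<v = Fin.toℕ u <ᵇ Fin.toℕ v

      v<u≡not : (Fin.toℕ v <ᵇ Fin.toℕ u) ≡ not u<v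
      v<u≡not = <ᵇ-asym (Fin.toℕ u) (Fin.toℕ v) (u≢v ∘ FinP.toℕ-injective)

      neg-swap : ∀ x y z → x ⊗ (- y ⊗ z) ≈ - (y ⊗ (x ⊗ z))
      neg-swap x y z = begin
        x ⊗ (- y ⊗ z)      ≈⟨ *-congˡ (-‿distribˡ-* y z) ⟨
        x ⊗ - (y ⊗ z)      ≈⟨ -‿distribʳ-* x (y ⊗ z) ⟨
        - (x ⊗ (y ⊗ z))    ≈⟨ -‿cong (x∙yz≈y∙xz x y z) ⟩
        - (y ⊗ (x ⊗ z))    ∎

    sign-anticommute : ∀ z → sign G u ⊗ (sign (G ∪ ⁅ u ⁆) v ⊗ z) ⊕ sign G v ⊗ (sign (G ∪ ⁅ v ⁆) u ⊗ z) ≈ 0#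
    sign-anticommute z rewrite sign-insert G v u∉G | sign-insert G u v∉G | v<u≡not = cancel u<v
      where
      cancel : ∀ b → sign G u ⊗ (negateIf b (sign G v) ⊗ z) ⊕ sign G v ⊗ (negateIf (not b) (sign G u) ⊗ z) ≈ 0#
      cancel true  = ≈-trans (+-congʳ (neg-swap _ _ z)) (-‿inverseˡ _)
      cancel false = ≈-trans (+-comm _ _) (≈-trans (+-congʳ (neg-swap _ _ z)) (-‿inverseˡ _))

    sign-swap : sign (G ∪ ⁅ u ⁆) v ⊗ sign (G ∪ ⁅ v ⁆) u ≈ - (sign G v ⊗ sign G u)
    sign-swap rewrite sign-insert G v u∉G | sign-insert G u v∉G | v<u≡not = swap u<v
      where
      swap : ∀ b → negateIf b (sign G v) ⊗ negateIf (not b) (sign G u) ≈ - (sign G v ⊗ sign G u)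
      swap true  = ≈-sym (-‿distribˡ-* _ _)
      swap false = ≈-sym (-‿distribʳ-* _ _)

  infixl 6 _+ᶜ_
  _+ᶜ_ : ∀ {r} → Chain r → Chain r → Chain r
  (c +ᶜ c') F = c F ⊕ c' F

  -ᶜ_ : ∀ {r} → Chain r → Chain r
  (-ᶜ c) F = - c F

  0ᶜ : ∀ {r} → Chain r
  0ᶜ _ = 0#

  ∂-cong : ∀ {r} {c c' : Chain r} → (∀ F → c F ≈ c' F) → ∀ G → ∂ c G ≈ ∂ c' G
  ∂-cong {c = c} {c'} c≈c' G = begin
    ∂ c G               ≡⟨ ∂≡sum c G ⟩
    sum (∂-term c G)    ≈⟨ sum-cong-≋ (λ v → unless-cong (lookup G v) (*-congˡ (c≈c' _))) ⟩
    sum (∂-term c' G)   ≡⟨ ∂≡sum c' G ⟨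
    ∂ c' G              ∎

  ∂-+ : ∀ {r} (c c' : Chain r) G → ∂ (c +ᶜ c') G ≈ ∂ c G ⊕ ∂ c' G
  ∂-+ c c' G = begin
    ∂ (c +ᶜ c') G                                    ≡⟨ ∂≡sum (c +ᶜ c') G ⟩
    sum (∂-term (c +ᶜ c') G)                         ≈⟨ sum-cong-≋ split ⟩
    sum (λ v → ∂-term c G v ⊕ ∂-term c' G v)         ≈⟨ ∑-distrib-+ (∂-term c G) (∂-term c' G) ⟩
    sum (∂-term c G) ⊕ sum (∂-term c' G)             ≡⟨ cong₂ _⊕_ (∂≡sum c G) (∂≡sum c' G) ⟨
    ∂ c G ⊕ ∂ c' G                                   ∎
    where
    split : ∀ v → ∂-term (c +ᶜ c') G v ≈ ∂-term c G v ⊕ ∂-term c' G v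
    split v = ≈-trans (unless-cong (lookup G v) (distribˡ _ _ _)) (unless-+ (lookup G v) _ _)

  ∂-neg : ∀ {r} (c : Chain r) G → ∂ (-ᶜ c) G ≈ - ∂ c G
  ∂-neg c G = begin
    ∂ (-ᶜ c) G                   ≡⟨ ∂≡sum (-ᶜ c) G ⟩
    sum (∂-term (-ᶜ c) G)        ≈⟨ sum-cong-≋ negate ⟩
    sum (λ v → - ∂-term c G v)   ≈⟨ sum-neg (∂-term c G) ⟩
    - sum (∂-term c G)           ≡⟨ cong -_ (∂≡sum c G) ⟨
    - ∂ c G                      ∎
    where
    negate : ∀ v → ∂-term (-ᶜ c) G v ≈ - ∂-term c G v
    negate v = ≈-trans (unless-cong (lookup G v) (≈-sym (-‿distribʳ-* _ _))) (unless-neg (lookup G v) _)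

  -- ∂ ∂ c at G is a double sum over pairs of new vertices u, v, in which the
  -- faces G ∪ {u} ∪ {v} reached in the two orders cancel.
  ∂∂ : ∀ {r} (c : Chain r) G → ∂ (∂ c) G ≈ 0#
  ∂∂ {r} c G = begin
    ∂ (∂ c) G                ≡⟨ ∂≡sum (∂ c) G ⟩
    sum (∂-term (∂ c) G)     ≈⟨ sum-cong-≋ expand ⟩
    sum (λ v → sum (f v))    ≈⟨ sum-antisymmetric f diagonal antisymmetric ⟩
    0#                       ∎
    where
    f : Fin r → Fin r → Carrier
    f v u = unless (lookup G v) (sign G v ⊗ ∂-term c (G ∪ ⁅ v ⁆) u)

    expand : ∀ v → ∂-term (∂ c) G v ≈ sum (f v)
    expand v = ≈-trans (unless-cong (lookup G v) (*-congˡ (≈-reflexive (∂≡sum c _))))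
                       (unless-scale-sum (lookup G v) _ {r} _)

    f-inner-member : ∀ v u → lookup (G ∪ ⁅ v ⁆) u ≡ true → f v u ≈ 0#
    f-inner-member v u u∈ =
      unless-zero (lookup G v) (≈-trans (*-congˡ (≈-reflexive (unless-true _ u∈))) (zeroʳ _))

    f-new : ∀ {u v} → u ≢ v → lookup G u ≡ false → lookup G v ≡ false →
            f u v ≡ sign G u ⊗ (sign (G ∪ ⁅ u ⁆) v ⊗ c ((G ∪ ⁅ u ⁆) ∪ ⁅ v ⁆))
    f-new u≢v u∉G v∉G = trans (unless-false _ u∉G) (cong (_ ⊗_) (unless-false _ (trans (insert-other G u≢v) v∉G)))

    diagonal : ∀ u → f u u ≈ 0#
    diagonal u = f-inner-member u u (insert-self G u)

    antisymmetric : ∀ u v → f u v ⊕ f v u ≈ 0#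
    antisymmetric u v with u Fin.≟ v
    ... | yes refl = ≈-trans (+-cong (diagonal u) (diagonal u)) (+-identityˡ 0#)
    ... | no u≢v   = by-membership (lookup G u) refl (lookup G v) refl
      where
      by-membership : ∀ bu → lookup G u ≡ bu → ∀ bv → lookup G v ≡ bv → f u v ⊕ f v u ≈ 0#
      by-membership true u∈G _ _ =
        ≈-trans (+-cong (≈-reflexive (unless-true _ u∈G)) (f-inner-member v u (insert-keeps G v u∈G))) (+-identityˡ 0#)
      by-membership false _ true v∈G =
        ≈-trans (+-cong (f-inner-member u v (insert-keeps G u v∈G)) (≈-reflexive (unless-true _ v∈G))) (+-identityˡ 0#)
      by-membership false u∉G false v∉G = begin
        f u v ⊕ f v u
          ≡⟨ cong₂ _⊕_ (f-new u≢v u∉G v∉G) (f-new (u≢v ∘ sym) v∉G u∉G) ⟩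
        sign G u ⊗ (sign (G ∪ ⁅ u ⁆) v ⊗ c X) ⊕ sign G v ⊗ (sign (G ∪ ⁅ v ⁆) u ⊗ c X′)
          ≈⟨ +-congˡ (*-congˡ (*-congˡ (≈-reflexive (cong c (insert-comm G v u))))) ⟩
        sign G u ⊗ (sign (G ∪ ⁅ u ⁆) v ⊗ c X) ⊕ sign G v ⊗ (sign (G ∪ ⁅ v ⁆) u ⊗ c X)
          ≈⟨ sign-anticommute G u≢v u∉G v∉G (c X) ⟩
        0# ∎
        where
        X  = (G ∪ ⁅ u ⁆) ∪ ⁅ v ⁆
        X′ = (G ∪ ⁅ v ⁆) ∪ ⁅ u ⁆

  module _ {r} {Δ : FacePred r} where

    chain-weaken : ∀ {Δ' : FacePred r} {i c} → Δ U.⊆ Δ' → IsChain Δ i c → IsChain Δ' i c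
    chain-weaken Δ⊆Δ' c-chain F ¬face = c-chain F (λ (face , size) → ¬face (Δ⊆Δ' face , size))

    chain-+ : ∀ {i c c'} → IsChain Δ i c → IsChain Δ i c' → IsChain Δ i (c +ᶜ c')
    chain-+ c-chain c'-chain F ¬face = ≈-trans (+-cong (c-chain F ¬face) (c'-chain F ¬face)) (+-identityˡ 0#)

    chain-neg : ∀ {i c} → IsChain Δ i c → IsChain Δ i (-ᶜ c)
    chain-neg c-chain F ¬face = ≈-trans (-‿cong (c-chain F ¬face)) -0#≈0#

    ∂-chain : DownwardClosed Δ → ∀ {i c} → IsChain Δ i c → IsChain Δ (i ℤ.- ℤ.1ℤ) (∂ c)
    ∂-chain Δ↓ {i} {c} c-chain G ¬face =
      ∂-vanishes c G (λ v v∉G → c-chain (G ∪ ⁅ v ⁆) (λ (face , size) → ¬face (Δ↓ G v face , lower v∉G size)))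
      where
      lower : ∀ {v} → lookup G v ≡ false → + ∣ G ∪ ⁅ v ⁆ ∣ ≡ i + ℤ.1ℤ → + ∣ G ∣ ≡ i ℤ.- ℤ.1ℤ + ℤ.1ℤ
      lower v∉G size = trans (+1-injective (trans (sym (+suc ∣ G ∣)) (trans (cong +_ (sym (∣insert∣ G v∉G))) size)))
                             (sym ([i-1]+1≡i i))

  -- Three principles for the vanishing of reduced homology

  vanishes-resp : ∀ {r} {Δ Δ' : FacePred r} {i} → Δ U.≐ Δ' →
    ReducedHomologyVanishes Δ i → ReducedHomologyVanishes Δ' i
  vanishes-resp {i = i} (Δ⊆Δ' , Δ'⊆Δ) vanish z (z-chain , z-cycle)
    with vanish z (chain-weaken {i = i} Δ'⊆Δ z-chain , z-cycle)
  ... | b , b-chain , ∂b≈z = b , chain-weaken {i = i + ℤ.1ℤ} Δ⊆Δ' b-chain , ∂b≈z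

  vanishes-without-faces : ∀ {r} {Δ : FacePred r} {i} → (∀ F → Δ F → + ∣ F ∣ ≢ i + ℤ.1ℤ) →
    ReducedHomologyVanishes Δ i
  vanishes-without-faces no-face z (z-chain , _) = 0ᶜ , (λ _ _ → ≈-refl) , ∂0≈z
    where
    ∂0≈z : ∀ G → ∂ 0ᶜ G ≈ z G
    ∂0≈z G = ≈-trans (∂-vanishes 0ᶜ G (λ _ _ → ≈-refl))
                     (≈-sym (z-chain G (λ (face , size) → no-face G face size)))

  vanishes-if-only-empty : ∀ {r} {Δ : FacePred r} {i} → (∀ F → Δ F → F ≡ ⊥) → ℤ.0ℤ ≤ i →
    ReducedHomologyVanishes Δ i
  vanishes-if-only-empty {r} {Δ} {i} only-empty 0≤i = vanishes-without-faces {i = i} no-face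
    where
    no-face : ∀ F → Δ F → + ∣ F ∣ ≢ i + ℤ.1ℤ
    no-face F face size = nonneg⇒i+1≢0 0≤i (trans (cong +_ (sym ∣F∣≡0)) size)
      where
      ∣F∣≡0 : ∣ F ∣ ≡ 0
      ∣F∣≡0 = trans (cong ∣_∣ (only-empty F face)) (∣⊥∣≡0 r)

  -- The cone operator (join with the apex w) gives
  -- F ∋ w the coefficient of F ∖ w, signed by the insertion of w; it is a
  -- chain homotopy from the identity to zero: ∂ ∘ cone + cone ∘ ∂ = id.
  module Cone {r} (w : Fin r) where

    cone : Chain r → Chain r
    cone c F = if lookup F w then sign (F ∖ w) w ⊗ c (F ∖ w) else 0#

    cone-apex : ∀ c {F} → lookup F w ≡ true → cone c F ≡ sign (F ∖ w) w ⊗ c (F ∖ w)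
    cone-apex c {F} w∈F = cong (λ b → if b then sign (F ∖ w) w ⊗ c (F ∖ w) else 0#) w∈F

    cone-no-apex : ∀ c {F} → lookup F w ≡ false → cone c F ≡ 0#
    cone-no-apex c {F} w∉F = cong (λ b → if b then sign (F ∖ w) w ⊗ c (F ∖ w) else 0#) w∉F

    cone-zero : ∀ {c} → (∀ F → c F ≈ 0#) → ∀ G → cone c G ≈ 0#
    cone-zero {c} c≈0 G with lookup G w
    ... | true  = ≈-trans (*-congˡ (c≈0 (G ∖ w))) (zeroʳ _)
    ... | false = ≈-refl

    -- Away from the apex only the term inserting w survives in ∂ (cone c).
    homotopy-off-apex : ∀ c G → lookup G w ≡ false → ∂ (cone c) G ⊕ cone (∂ c) G ≈ c G
    homotopy-off-apex c G w∉G = begin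
      ∂ (cone c) G ⊕ cone (∂ c) G   ≈⟨ +-cong ∂cone (≈-reflexive (cone-no-apex (∂ c) w∉G)) ⟩
      c G ⊕ 0#                      ≈⟨ +-identityʳ (c G) ⟩
      c G                           ∎
      where
      others : ∀ v → v ≢ w → ∂-term (cone c) G v ≈ 0#
      others v v≢w = unless-zero (lookup G v)
        (≈-trans (*-congˡ (≈-reflexive (cone-no-apex c (trans (insert-other G v≢w) w∉G)))) (zeroʳ _))

      ∂cone : ∂ (cone c) G ≈ c G
      ∂cone = begin
        ∂ (cone c) G                    ≡⟨ ∂≡sum (cone c) G ⟩
        sum (∂-term (cone c) G)         ≈⟨ sum-single (∂-term (cone c) G) w others ⟩
        ∂-term (cone c) G w             ≡⟨ unless-false _ w∉G ⟩
        sign G w ⊗ cone c (G ∪ ⁅ w ⁆)   ≡⟨ cong (sign G w ⊗_) (cone-apex c (insert-self G w)) ⟩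
        sign G w ⊗ (sign ((G ∪ ⁅ w ⁆) ∖ w) w ⊗ c ((G ∪ ⁅ w ⁆) ∖ w))
                                        ≡⟨ cong (λ H → sign G w ⊗ (sign H w ⊗ c H)) (insert-delete G w∉G) ⟩
        sign G w ⊗ (sign G w ⊗ c G)     ≈⟨ sign-cancel G w (c G) ⟩
        c G                             ∎

    -- At a face G ∋ w, with H = G ∖ w and ε the sign of inserting w into H,
    -- the terms of ∂ (cone c) at G are -ε times the terms of ∂ c at H other
    -- than the one for w, which is ε · c G.
    homotopy-at-apex : ∀ c G → lookup G w ≡ true → ∂ (cone c) G ⊕ cone (∂ c) G ≈ c G
    homotopy-at-apex c G w∈G = begin
      ∂ (cone c) G ⊕ cone (∂ c) G
        ≈⟨ +-cong (≈-trans (≈-reflexive (∂≡sum (cone c) G)) (sum-cong-≋ ∂cone-term))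
                  (≈-reflexive (cone-apex (∂ c) w∈G)) ⟩
      sum (λ v → - (ε ⊗ R v)) ⊕ ε ⊗ ∂ c H
        ≈⟨ +-cong (≈-trans (sum-neg (λ v → ε ⊗ R v)) (-‿cong (≈-sym (*-distribˡ-sum ε R)))) (*-congˡ ∂c-at-H) ⟩
      - (ε ⊗ sum R) ⊕ ε ⊗ (ε ⊗ c G ⊕ sum R)
        ≈⟨ +-congˡ (distribˡ ε _ _) ⟩
      - (ε ⊗ sum R) ⊕ (ε ⊗ (ε ⊗ c G) ⊕ ε ⊗ sum R)
        ≈⟨ cancel (ε ⊗ sum R) (ε ⊗ (ε ⊗ c G)) ⟩
      ε ⊗ (ε ⊗ c G)
        ≈⟨ sign-cancel H w (c G) ⟩
      c G ∎
      where
      H = G ∖ w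
      ε = sign H w

      H∪w≡G : H ∪ ⁅ w ⁆ ≡ G
      H∪w≡G = delete-insert G w∈G

      R : Fin r → Carrier
      R v = unless (lookup G v) (sign H v ⊗ c (H ∪ ⁅ v ⁆))

      ∂c-at-H : ∂ c H ≈ ε ⊗ c G ⊕ sum R
      ∂c-at-H = begin
        ∂ c H                  ≡⟨ ∂≡sum c H ⟩
        sum (∂-term c H)       ≈⟨ sum-split (∂-term c H) R w (≈-reflexive (unless-true _ w∈G)) same-off-w ⟩
        ∂-term c H w ⊕ sum R   ≡⟨ cong (_⊕ sum R) (trans (unless-false _ (delete-self G w)) (cong (λ F → ε ⊗ c F) H∪w≡G)) ⟩
        ε ⊗ c G ⊕ sum R        ∎
        where
        same-off-w : ∀ v → v ≢ w → ∂-term c H v ≈ R v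
        same-off-w v v≢w =
          ≈-reflexive (cong (λ b → unless b (sign H v ⊗ c (H ∪ ⁅ v ⁆))) (delete-other G (v≢w ∘ sym)))

      ∂cone-term : ∀ v → ∂-term (cone c) G v ≈ - (ε ⊗ R v)
      ∂cone-term v = by-membership (lookup G v) refl
        where
        by-membership : ∀ b → lookup G v ≡ b → ∂-term (cone c) G v ≈ - (ε ⊗ R v)
        by-membership true v∈G = begin
          ∂-term (cone c) G v   ≡⟨ unless-true _ v∈G ⟩
          0#                    ≈⟨ -0#≈0# ⟨
          - 0#                  ≈⟨ -‿cong (zeroʳ ε) ⟨
          - (ε ⊗ 0#)            ≡⟨ cong (λ x → - (ε ⊗ x)) (unless-true _ v∈G) ⟨
          - (ε ⊗ R v)           ∎
        by-membership false v∉G = begin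
          ∂-term (cone c) G v
            ≡⟨ unless-false _ v∉G ⟩
          sign G v ⊗ cone c (G ∪ ⁅ v ⁆)
            ≡⟨ cong (sign G v ⊗_) (cone-apex c (insert-keeps G v w∈G)) ⟩
          sign G v ⊗ (sign ((G ∪ ⁅ v ⁆) ∖ w) w ⊗ c ((G ∪ ⁅ v ⁆) ∖ w))
            ≡⟨ cong₂ (λ F F' → sign F v ⊗ (sign F' w ⊗ c F')) (sym H∪w≡G) (insert-delete-comm G v≢w) ⟩
          sign (H ∪ ⁅ w ⁆) v ⊗ (sign (H ∪ ⁅ v ⁆) w ⊗ c (H ∪ ⁅ v ⁆))
            ≈⟨ *-assoc _ _ _ ⟨
          (sign (H ∪ ⁅ w ⁆) v ⊗ sign (H ∪ ⁅ v ⁆) w) ⊗ c (H ∪ ⁅ v ⁆)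
            ≈⟨ *-congʳ (sign-swap H (v≢w ∘ sym) (delete-self G w) v∉H) ⟩
          - (sign H v ⊗ ε) ⊗ c (H ∪ ⁅ v ⁆)
            ≈⟨ -‿distribˡ-* _ _ ⟨
          - ((sign H v ⊗ ε) ⊗ c (H ∪ ⁅ v ⁆))
            ≈⟨ -‿cong (≈-trans (*-assoc _ _ _) (x∙yz≈y∙xz _ _ _)) ⟩
          - (ε ⊗ (sign H v ⊗ c (H ∪ ⁅ v ⁆)))
            ≡⟨ cong (λ x → - (ε ⊗ x)) (unless-false _ v∉G) ⟨
          - (ε ⊗ R v) ∎
          where
          v≢w : v ≢ w
          v≢w refl with trans (sym v∉G) w∈G
          ... | ()
          v∉H : lookup H v ≡ false
          v∉H = trans (delete-other G (v≢w ∘ sym)) v∉G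

      cancel : ∀ a b → - a ⊕ (b ⊕ a) ≈ b
      cancel a b = begin
        - a ⊕ (b ⊕ a)   ≈⟨ +-congˡ (+-comm b a) ⟩
        - a ⊕ (a ⊕ b)   ≈⟨ +-assoc _ _ _ ⟨
        (- a ⊕ a) ⊕ b   ≈⟨ +-congʳ (-‿inverseˡ a) ⟩
        0# ⊕ b          ≈⟨ +-identityˡ b ⟩
        b               ∎

    cone-homotopy : ∀ c G → ∂ (cone c) G ⊕ cone (∂ c) G ≈ c G
    cone-homotopy c G = by-apex (lookup G w) refl
      where
      by-apex : ∀ b → lookup G w ≡ b → ∂ (cone c) G ⊕ cone (∂ c) G ≈ c G
      by-apex true  = homotopy-at-apex c G
      by-apex false = homotopy-off-apex c G

  -- A cycle z of a cone is the boundary of cone z.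
  cone-acyclic : ∀ {r} {Δ : FacePred r} w → IsConeWithApex Δ w → ∀ i → ReducedHomologyVanishes Δ i
  cone-acyclic {Δ = Δ} w apex i z (z-chain , z-cycle) = cone z , cone-chain , ∂cone≈z
    where
    open Cone w

    cone-chain : IsChain Δ (i + ℤ.1ℤ) (cone z)
    cone-chain F ¬face = by-apex (lookup F w) refl
      where
      by-apex : ∀ b → lookup F w ≡ b → cone z F ≈ 0#
      by-apex false w∉F = ≈-reflexive (cone-no-apex z w∉F)
      by-apex true  w∈F = ≈-trans (≈-reflexive (cone-apex z w∈F))
                                  (≈-trans (*-congˡ (z-chain (F ∖ w) ¬base)) (zeroʳ _))
        where
        ¬base : ¬ (Δ (F ∖ w) × + ∣ F ∖ w ∣ ≡ i + ℤ.1ℤ)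
        ¬base (face , size) = ¬face (subst Δ (delete-insert F w∈F) (apex _ face) , raise size)
          where
          raise : + ∣ F ∖ w ∣ ≡ i + ℤ.1ℤ → + ∣ F ∣ ≡ i + ℤ.1ℤ + ℤ.1ℤ
          raise eq = trans (cong (+_ ∘ ∣_∣) (sym (delete-insert F w∈F)))
                     (trans (cong +_ (∣insert∣ (F ∖ w) (delete-self F w)))
                     (trans (+suc _) (cong (_+ ℤ.1ℤ) eq)))

    ∂cone≈z : ∀ G → ∂ (cone z) G ≈ z G
    ∂cone≈z G = begin
      ∂ (cone z) G                  ≈⟨ +-identityʳ _ ⟨
      ∂ (cone z) G ⊕ 0#             ≈⟨ +-congˡ (cone-zero z-cycle G) ⟨
      ∂ (cone z) G ⊕ cone (∂ z) G   ≈⟨ cone-homotopy z G ⟩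
      z G                           ∎

  -- (3) Mayer–Vietoris: if X is decidable and X, Y are downward closed, then
  -- H̃ᵢ(X) = 0, H̃ᵢ(Y) = 0 and H̃ᵢ₋₁(X ∩ Y) = 0 imply H̃ᵢ(X ∪ Y) = 0.
  -- An i-cycle z of X ∪ Y splits as z = x + y with x supported on X and y on
  -- Y; then ∂x = -∂y is an (i-1)-cycle of X ∩ Y, say ∂x = ∂w, and x - w,
  -- y + w are i-cycles of X and of Y whose fillings add up to one of z.
  module _ {r} {X Y : FacePred r} (X? : U.Decidable X) (X↓ : DownwardClosed X) (Y↓ : DownwardClosed Y)
           {i : ℤ} where

    private
      module Split (z : Chain r) (z-chain : IsChain (X U.∪ Y) i z) (z-cycle : ∀ G → ∂ z G ≈ 0#) where

        x y : Chain r
        x F = if does (X? F) then z F else 0#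
        y F = if does (X? F) then 0# else z F

        z≈x+y : ∀ F → z F ≈ x F ⊕ y F
        z≈x+y F with X? F
        ... | yes _ = ≈-sym (+-identityʳ (z F))
        ... | no  _ = ≈-sym (+-identityˡ (z F))

        x-chain : IsChain X i x
        x-chain F ¬face with X? F
        ... | yes xF = z-chain F (λ (_ , size) → ¬face (xF , size))
        ... | no  _  = ≈-refl

        y-chain : IsChain Y i y
        y-chain F ¬face with X? F
        ... | yes _   = ≈-refl
        ... | no  ¬xF = z-chain F λ { (inj₁ xF , _) → ¬xF xF ; (inj₂ yF , size) → ¬face (yF , size) }

        ∂x≈-∂y : ∀ G → ∂ x G ≈ - ∂ y G
        ∂x≈-∂y G = +-inverseʳ-unique (∂ y G) (∂ x G) (begin
          ∂ y G ⊕ ∂ x G    ≈⟨ +-comm _ _ ⟩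
          ∂ x G ⊕ ∂ y G    ≈⟨ ∂-+ x y G ⟨
          ∂ (x +ᶜ y) G     ≈⟨ ∂-cong (≈-sym ∘ z≈x+y) G ⟩
          ∂ z G            ≈⟨ z-cycle G ⟩
          0#               ∎)

        ∂x-chain : IsChain (X U.∩ Y) (i ℤ.- ℤ.1ℤ) (∂ x)
        ∂x-chain G ¬face with X? G
        ... | yes xG = ≈-trans (∂x≈-∂y G)
                         (≈-trans (-‿cong (∂-chain Y↓ {i} y-chain G (λ (yG , size) → ¬face ((xG , yG) , size)))) -0#≈0#)
        ... | no ¬xG = ∂-chain X↓ {i} x-chain G (λ (xG , _) → ¬xG xG)

        module _ (w : Chain r) (w-chain : IsChain (X U.∩ Y) (i ℤ.- ℤ.1ℤ + ℤ.1ℤ) w)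
                 (∂w≈∂x : ∀ G → ∂ w G ≈ ∂ x G) where

          w-chain′ : IsChain (X U.∩ Y) i w
          w-chain′ = subst (λ k → IsChain (X U.∩ Y) k w) ([i-1]+1≡i i) w-chain

          x-w-cycle : IsCycle X i (x +ᶜ -ᶜ w)
          x-w-cycle = chain-+ {i = i} x-chain (chain-neg {i = i} (chain-weaken {i = i} proj₁ w-chain′)) , λ G → begin
            ∂ (x +ᶜ -ᶜ w) G        ≈⟨ ∂-+ x (-ᶜ w) G ⟩
            ∂ x G ⊕ ∂ (-ᶜ w) G     ≈⟨ +-congˡ (≈-trans (∂-neg w G) (-‿cong (∂w≈∂x G))) ⟩
            ∂ x G ⊕ - ∂ x G        ≈⟨ -‿inverseʳ _ ⟩
            0#                     ∎

          y+w-cycle : IsCycle Y i (y +ᶜ w)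
          y+w-cycle = chain-+ {i = i} y-chain (chain-weaken {i = i} proj₂ w-chain′) , λ G → begin
            ∂ (y +ᶜ w) G           ≈⟨ ∂-+ y w G ⟩
            ∂ y G ⊕ ∂ w G          ≈⟨ +-congˡ (∂w≈∂x G) ⟩
            ∂ y G ⊕ ∂ x G          ≈⟨ +-congˡ (∂x≈-∂y G) ⟩
            ∂ y G ⊕ - ∂ y G        ≈⟨ -‿inverseʳ _ ⟩
            0#                     ∎

          glue : ∀ p q → (∀ G → ∂ p G ≈ (x +ᶜ -ᶜ w) G) → (∀ G → ∂ q G ≈ (y +ᶜ w) G) →
                 ∀ G → ∂ (p +ᶜ q) G ≈ z G
          glue p q ∂p ∂q G = begin
            ∂ (p +ᶜ q) G                  ≈⟨ ∂-+ p q G ⟩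
            ∂ p G ⊕ ∂ q G                 ≈⟨ +-cong (∂p G) (∂q G) ⟩
            (x G ⊕ - w G) ⊕ (y G ⊕ w G)   ≈⟨ +-congˡ (+-comm _ _) ⟩
            (x G ⊕ - w G) ⊕ (w G ⊕ y G)   ≈⟨ +-assoc _ _ _ ⟨
            ((x G ⊕ - w G) ⊕ w G) ⊕ y G   ≈⟨ +-congʳ (+-assoc _ _ _) ⟩
            (x G ⊕ (- w G ⊕ w G)) ⊕ y G   ≈⟨ +-congʳ (+-congˡ (-‿inverseˡ _)) ⟩
            (x G ⊕ 0#) ⊕ y G              ≈⟨ +-congʳ (+-identityʳ _) ⟩
            x G ⊕ y G                     ≈⟨ z≈x+y G ⟨
            z G                           ∎

    mayer-vietoris : ReducedHomologyVanishes X i → ReducedHomologyVanishes Y i →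
      ReducedHomologyVanishes (X U.∩ Y) (i ℤ.- ℤ.1ℤ) → ReducedHomologyVanishes (X U.∪ Y) i
    mayer-vietoris fill-X fill-Y fill-X∩Y z (z-chain , z-cycle) = glue-fillings (fill-X∩Y (∂ x) (∂x-chain , ∂∂ x))
      where
      open Split z z-chain z-cycle
      i′ = i + ℤ.1ℤ

      glue-fillings : IsBoundary (X U.∩ Y) (i ℤ.- ℤ.1ℤ) (∂ x) → IsBoundary (X U.∪ Y) i z
      glue-fillings (w , w-chain , ∂w≈∂x)
        with fill-X (x +ᶜ -ᶜ w) (x-w-cycle w w-chain ∂w≈∂x) | fill-Y (y +ᶜ w) (y+w-cycle w w-chain ∂w≈∂x)
      ... | p , p-chain , ∂p | q , q-chain , ∂q =
        p +ᶜ q ,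
        chain-+ {i = i′} (chain-weaken {i = i′} inj₁ p-chain) (chain-weaken {i = i′} inj₂ q-chain) ,
        glue w w-chain ∂w≈∂x p q ∂p ∂q

  -- A full simplex is acyclic in degrees ≥ 0: it is a cone over any of its
  -- vertices, and when V = ∅ its only face is ∅.
  simplex-acyclic : ∀ {r} (V : Subset r) {i} → ℤ.0ℤ ≤ i → ReducedHomologyVanishes (Simplex V) i
  simplex-acyclic V {i} 0≤i with nonempty? V
  ... | yes (w , w∈V) = cone-acyclic w (simplex-is-cone w∈V) i
  ... | no  V-empty   = vanishes-if-only-empty only-empty 0≤i
    where
    only-empty : ∀ F → Simplex V F → F ≡ ⊥
    only-empty F F⊆V = Empty-unique (λ (a , a∈F) → V-empty (a , F⊆V a∈F))

module _ {m : ℕ} where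

  ∈-⋂⁺ : ∀ {r} (A : Fin r → Subset m) F {x} → (∀ {a} → a ∈ F → x ∈ A a) → x ∈ ⋂ r A F
  ∈-⋂⁺ {ℕ.zero}  A F           _  = ∈⊤
  ∈-⋂⁺ {ℕ.suc r} A (true  ∷ F) in-all = x∈p∩q⁺ (in-all here , ∈-⋂⁺ (A ∘ Fin.suc) F (in-all ∘ there))
  ∈-⋂⁺ {ℕ.suc r} A (false ∷ F) in-all = x∈p∩q⁺ (∈⊤ , ∈-⋂⁺ (A ∘ Fin.suc) F (in-all ∘ there))

  ∈-⋂⁻ : ∀ {r} (A : Fin r → Subset m) F {x} → x ∈ ⋂ r A F → ∀ {a} → a ∈ F → x ∈ A a
  ∈-⋂⁻ {ℕ.suc r} A (true ∷ F) x∈⋂ here        = proj₁ (x∈p∩q⁻ (A Fin.zero) _ x∈⋂)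
  ∈-⋂⁻ {ℕ.suc r} A (b ∷ F)    x∈⋂ (there a∈F) = ∈-⋂⁻ (A ∘ Fin.suc) F (proj₂ (x∈p∩q⁻ _ _ x∈⋂)) a∈F

  module _ {r} (A : Fin r → Subset m) where

    ⋂-antitone : ∀ {F G} → F ⊆ G → ⋂ r A G ⊆ ⋂ r A F
    ⋂-antitone {F} {G} F⊆G x∈⋂G = ∈-⋂⁺ A F (λ a∈F → ∈-⋂⁻ A G x∈⋂G (F⊆G a∈F))

    ⋂⊆facet : ∀ {F a} → a ∈ F → ⋂ r A F ⊆ A a
    ⋂⊆facet {F} a∈F x∈⋂F = ∈-⋂⁻ A F x∈⋂F a∈F

module _ {m : ℕ} where

  ∈-tail⁺ : ∀ {p : Subset (ℕ.suc m)} {x} → Fin.suc x ∈ p → x ∈ tail p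
  ∈-tail⁺ {_ ∷ _} = drop-there

  ∈-tail⁻ : ∀ {p : Subset (ℕ.suc m)} {x} → x ∈ tail p → Fin.suc x ∈ p
  ∈-tail⁻ {_ ∷ _} = there

  ∈-head⁺ : ∀ {p : Subset (ℕ.suc m)} → Fin.zero ∈ p → head p ≡ true
  ∈-head⁺ {_ ∷ _} here = refl

  ∈-head⁻ : ∀ {p : Subset (ℕ.suc m)} → head p ≡ true → Fin.zero ∈ p
  ∈-head⁻ {true ∷ _} refl = here

  module FirstVertex {r} (A : Fin r → Subset (ℕ.suc m)) where

    B : Fin r → Subset m
    B a = tail (A a)

    W : Subset r
    W = tabulate (λ a → head (A a))

    ∈W⁺ : ∀ {a} → Fin.zero ∈ A a → a ∈ W
    ∈W⁺ {a} 0∈Aa = lookup⇒[]= a W (trans (lookup∘tabulate (λ a → head (A a)) a) (∈-head⁺ 0∈Aa))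

    ∈W⁻ : ∀ {a} → a ∈ W → Fin.zero ∈ A a
    ∈W⁻ {a} a∈W = ∈-head⁻ (trans (sym (lookup∘tabulate (λ a → head (A a)) a)) ([]=⇒lookup a∈W))

    tail-⋂ : ∀ F → tail (⋂ r A F) ≡ ⋂ r B F
    tail-⋂ F = ⊆-antisym
      (λ x∈ → ∈-⋂⁺ B F (λ a∈F → ∈-tail⁺ (∈-⋂⁻ A F (∈-tail⁻ x∈) a∈F)))
      (λ x∈ → ∈-tail⁺ (∈-⋂⁺ A F (λ a∈F → ∈-tail⁻ (∈-⋂⁻ B F x∈ a∈F))))

    ⋂-first-in : ∀ {F} → F ⊆ W → ∣ ⋂ r A F ∣ ≡ ℕ.suc ∣ ⋂ r B F ∣
    ⋂-first-in {F} F⊆W = trans (∣∣-first-in (∈-⋂⁺ A F (∈W⁻ ∘ F⊆W))) (cong (ℕ.suc ∘ ∣_∣) (tail-⋂ F))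

    ⋂-first-out : ∀ {F} → ¬ F ⊆ W → ∣ ⋂ r A F ∣ ≡ ∣ ⋂ r B F ∣
    ⋂-first-out {F} F⊈W = trans (∣∣-first-out 0∉⋂) (cong ∣_∣ (tail-⋂ F))
      where
      0∉⋂ : Fin.zero ∉ ⋂ r A F
      0∉⋂ 0∈⋂ = F⊈W (λ a∈F → ∈W⁺ (∈-⋂⁻ A F 0∈⋂ a∈F))

    ⋂-first-≤ : ∀ F → ∣ ⋂ r B F ∣ ℕ.≤ ∣ ⋂ r A F ∣
    ⋂-first-≤ F = subst (ℕ._≤ ∣ ⋂ r A F ∣) (cong ∣_∣ (tail-⋂ F)) (∣tail∣≤ (⋂ r A F))

Nerve : ∀ {m r} → (Fin r → Subset m) → Subset r → ℤ → FacePred r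
Nerve A V j F = F ⊆ V × nerveFace A j F

≤+suc⇒pred≤ : ∀ {j} n → j ≤ + ℕ.suc n → j ℤ.- ℤ.1ℤ ≤ + n
≤+suc⇒pred≤ n j≤ = ℤP.+-monoˡ-≤ ℤ.-1ℤ j≤

pred≤⇒≤+suc : ∀ {j} n → j ℤ.- ℤ.1ℤ ≤ + n → j ≤ + ℕ.suc n
pred≤⇒≤+suc {j} n j-1≤ = subst₂ _≤_ ([i-1]+1≡i j) (sym (+suc n)) (ℤP.+-monoˡ-≤ ℤ.1ℤ j-1≤)

module _ {m r} (A : Fin r → Subset m) where

  nerveFace-threshold : ∀ {j j' F} → j' ≤ j → nerveFace A j F → nerveFace A j' F
  nerveFace-threshold _    (inj₁ F≡∅) = inj₁ F≡∅
  nerveFace-threshold j'≤j (inj₂ j≤)  = inj₂ (ℤP.≤-trans j'≤j j≤)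

  nerveFace-downward : ∀ {j F G} → F ⊆ G → nerveFace A j G → nerveFace A j F
  nerveFace-downward {F = F} F⊆G (inj₁ refl) = inj₁ (Empty-unique (λ (a , a∈F) → ∉⊥ (F⊆G a∈F)))
  nerveFace-downward {F = F} {G} F⊆G (inj₂ j≤) = inj₂ (ℤP.≤-trans j≤ (ℤ.+≤+ (p⊆q⇒∣p∣≤∣q∣ (⋂-antitone A F⊆G))))

  nerve-downward : ∀ {V j} → DownwardClosed (Nerve A V j)
  nerve-downward G v (G∪v⊆V , face) = (G∪v⊆V ∘ p⊆p∪q ⁅ v ⁆) , nerveFace-downward (p⊆p∪q ⁅ v ⁆) face

  nerve? : ∀ V j → U.Decidable (Nerve A V j)
  nerve? V j F = (F ⊆? V) ×-dec ((≡-dec BoolP._≟_ F ⊥) ⊎-dec (j ℤP.≤? + ∣ ⋂ r A F ∣))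

  nerve-only-empty : ∀ {V d j} → (∀ a → a ∈ V → + ∣ A a ∣ ≤ d) → d < j → ∀ F → Nerve A V j F → F ≡ ⊥
  nerve-only-empty _ _ F (_ , inj₁ F≡∅) = F≡∅
  nerve-only-empty {d = d} {j} bound d<j F (F⊆V , inj₂ j≤⋂) with nonempty? F
  ... | no  F-empty     = Empty-unique F-empty
  ... | yes (a , a∈F) = contradiction j≤d (ℤP.<⇒≱ d<j)
    where
    open ℤP.≤-Reasoning
    j≤d : j ≤ d
    j≤d = begin
      j              ≤⟨ j≤⋂ ⟩
      + ∣ ⋂ r A F ∣  ≤⟨ ℤ.+≤+ (p⊆q⇒∣p∣≤∣q∣ (⋂⊆facet A a∈F)) ⟩
      + ∣ A a ∣      ≤⟨ bound a (F⊆V a∈F) ⟩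
      d              ∎

  nerve-simplex : ∀ {V j} → j ≤ ℤ.0ℤ → Simplex V U.≐ Nerve A V j
  nerve-simplex j≤0 = (λ F⊆V → F⊆V , inj₂ (ℤP.≤-trans j≤0 (ℤ.+≤+ ℕ.z≤n))) , proj₁

module NerveSplit {m r} (A : Fin r → Subset (ℕ.suc m)) (V : Subset r) (j : ℤ) where
  open FirstVertex A public

  private
    ⊆V∩W : ∀ {F} → F ⊆ V → F ⊆ W → F ⊆ V ∩ W
    ⊆V∩W F⊆V F⊆W x∈F = x∈p∩q⁺ (F⊆V x∈F , F⊆W x∈F)

    ⊆V : ∀ {F} → F ⊆ V ∩ W → F ⊆ V
    ⊆V F⊆V∩W = p∩q⊆p V W ∘ F⊆V∩W

    ⊆W : ∀ {F} → F ⊆ V ∩ W → F ⊆ W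
    ⊆W F⊆V∩W = p∩q⊆q V W ∘ F⊆V∩W

  nerve-union : Nerve A V j U.≐ (Nerve B V j U.∪ Nerve B (V ∩ W) (j ℤ.- ℤ.1ℤ))
  nerve-union = split , join
    where
    split : Nerve A V j U.⊆ (Nerve B V j U.∪ Nerve B (V ∩ W) (j ℤ.- ℤ.1ℤ))
    split (F⊆V , inj₁ F≡∅) = inj₁ (F⊆V , inj₁ F≡∅)
    split {F} (F⊆V , inj₂ j≤) with F ⊆? W
    ... | yes F⊆W = inj₂ (⊆V∩W F⊆V F⊆W , inj₂ (≤+suc⇒pred≤ _ (subst (λ n → j ≤ + n) (⋂-first-in F⊆W) j≤)))
    ... | no  F⊈W = inj₁ (F⊆V , inj₂ (subst (λ n → j ≤ + n) (⋂-first-out F⊈W) j≤))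

    join : (Nerve B V j U.∪ Nerve B (V ∩ W) (j ℤ.- ℤ.1ℤ)) U.⊆ Nerve A V j
    join (inj₁ (F⊆V , inj₁ F≡∅)) = F⊆V , inj₁ F≡∅
    join {F} (inj₁ (F⊆V , inj₂ j≤)) = F⊆V , inj₂ (ℤP.≤-trans j≤ (ℤ.+≤+ (⋂-first-≤ F)))
    join (inj₂ (F⊆V∩W , inj₁ F≡∅)) = ⊆V F⊆V∩W , inj₁ F≡∅
    join (inj₂ (F⊆V∩W , inj₂ j-1≤)) =
      ⊆V F⊆V∩W , inj₂ (subst (λ n → j ≤ + n) (sym (⋂-first-in (⊆W F⊆V∩W))) (pred≤⇒≤+suc _ j-1≤))

  nerve-intersection : (Nerve B V j U.∩ Nerve B (V ∩ W) (j ℤ.- ℤ.1ℤ)) U.≐ Nerve B (V ∩ W) j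
  nerve-intersection =
    (λ ((_ , face) , (F⊆V∩W , _)) → F⊆V∩W , face) ,
    (λ (F⊆V∩W , face) → (⊆V F⊆V∩W , face) , (F⊆V∩W , nerveFace-threshold B (ℤP.i-j≤i j ℤ.1ℤ) face))

maxCard-bound : ∀ {n} r (A : Fin r → Subset n) a → ∣ A a ∣ ℕ.≤ maxCard r A
maxCard-bound (ℕ.suc r) A Fin.zero    = ℕP.m≤m⊔n _ _
maxCard-bound (ℕ.suc r) A (Fin.suc a) = ℕP.≤-trans (maxCard-bound r (A ∘ Fin.suc) a) (ℕP.m≤n⊔m _ _)

module Vanishing {c ℓ : Level} (K : Field c ℓ) where
  open Chains K
  open Homology K using (ReducedHomologyVanishes)

  nerve-vanishing : ∀ m {r} (A : Fin r → Subset m) (V : Subset r) (d j i : ℤ) →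
    (∀ a → a ∈ V → + ∣ A a ∣ ≤ d) → d < i + j → ℤ.0ℤ ≤ i →
    ReducedHomologyVanishes (Nerve A V j) i
  nerve-vanishing m A V d j i bound d<i+j 0≤i with d ℤP.<? j
  ... | yes d<j = vanishes-if-only-empty (nerve-only-empty A bound d<j) 0≤i
  nerve-vanishing ℕ.zero A V d j i _ _ 0≤i | no _ with ℤ.0ℤ ℤP.<? j
  ... | yes 0<j = vanishes-if-only-empty (nerve-only-empty A no-vertices 0<j) 0≤i
    where
    no-vertices : ∀ a → a ∈ V → + ∣ A a ∣ ≤ ℤ.0ℤ
    no-vertices a _ = ℤ.+≤+ (ℕP.≤-reflexive (∣∣-no-vertices (A a)))
  ... | no  0≮j = vanishes-resp {i = i} (nerve-simplex A (ℤP.≮⇒≥ 0≮j)) (simplex-acyclic V 0≤i)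
  nerve-vanishing (ℕ.suc m) A V d j i bound d<i+j 0≤i | no d≮j =
    vanishes-resp {i = i} (≐-sym nerve-union)
      (mayer-vietoris (nerve? B V j) (nerve-downward B) (nerve-downward B) {i} acyclic-X acyclic-Y acyclic-X∩Y)
    where
    -- X = N_j(B, V) and Y = N_{j-1}(B, V ∩ W) cover N_j(A, V), and the
    -- three pieces satisfy the induction hypothesis (for X ∩ Y in degree
    -- i - 1 ≥ 0, as j ≤ d < i + j forces i > 0).
    open NerveSplit A V j

    bound-B : ∀ a → a ∈ V → + ∣ B a ∣ ≤ d
    bound-B a a∈V = ℤP.≤-trans (ℤ.+≤+ (∣tail∣≤ (A a))) (bound a a∈V)

    -- the facets in W lose the deleted vertex
    bound-BW : ∀ a → a ∈ V ∩ W → + ∣ B a ∣ ≤ d ℤ.- ℤ.1ℤ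
    bound-BW a a∈V∩W = ℤP.+-monoˡ-≤ ℤ.-1ℤ (subst (λ n → + n ≤ d) ∣Aa∣≡1+∣Ba∣ (bound a (p∩q⊆p V W a∈V∩W)))
      where
      ∣Aa∣≡1+∣Ba∣ : ∣ A a ∣ ≡ ℕ.suc ∣ B a ∣
      ∣Aa∣≡1+∣Ba∣ = ∣∣-first-in (∈W⁻ (p∩q⊆q V W a∈V∩W))

    acyclic-X : ReducedHomologyVanishes (Nerve B V j) i
    acyclic-X = nerve-vanishing m B V d j i bound-B d<i+j 0≤i

    acyclic-Y : ReducedHomologyVanishes (Nerve B (V ∩ W) (j ℤ.- ℤ.1ℤ)) i
    acyclic-Y = nerve-vanishing m B (V ∩ W) (d ℤ.- ℤ.1ℤ) (j ℤ.- ℤ.1ℤ) i bound-BW (lower-d-and-j i j d<i+j) 0≤i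

    acyclic-X∩Y : ReducedHomologyVanishes (Nerve B V j U.∩ Nerve B (V ∩ W) (j ℤ.- ℤ.1ℤ)) (i ℤ.- ℤ.1ℤ)
    acyclic-X∩Y = vanishes-resp {i = i ℤ.- ℤ.1ℤ} (≐-sym nerve-intersection)
            (nerve-vanishing m B (V ∩ W) (d ℤ.- ℤ.1ℤ) j (i ℤ.- ℤ.1ℤ) bound-BW (lower-d-and-i i j d<i+j)
              (positive⇒pred-nonneg (positive-gap i j (ℤP.≮⇒≥ d≮j) d<i+j)))

-- This is the case V = all facets.

corollary3p8 : ∀ {c ℓ : Level} (K : Field c ℓ) (n r : ℕ) (A : Fin r → Subset n) →
    AreFacets A →
    (∃ λ a → Nonempty (A a)) →
    ∀ (i j : ℤ) → + maxCard r A < i + j → + 1 ≤ j → j ≤ + maxCard r A →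
    Homology.ReducedHomologyVanishes K (nerveFace A j) i
corollary3p8 K n r A _ _ i j d<i+j _ j≤d =
  vanishes-resp {i = i} all-facets (nerve-vanishing n A ⊤ (+ maxCard r A) j i facet-bound d<i+j 0≤i)
  where
  open Vanishing K
  open Chains K using (vanishes-resp)

  all-facets : Nerve A ⊤ j U.≐ nerveFace A j
  all-facets = proj₂ , (λ face → (λ _ → ∈⊤) , face)

  facet-bound : ∀ a → a ∈ ⊤ → + ∣ A a ∣ ≤ + maxCard r A
  facet-bound a _ = ℤ.+≤+ (maxCard-bound r A a)

  0≤i : ℤ.0ℤ ≤ i
  0≤i = ℤP.<⇒≤ (positive-gap i j j≤d d<i+j)
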